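{- Let $n \geq 2$ and let $x_1, x_2, \ldots, x_{n-1}$ be pairwise distinct positive integers, so that $(x_1, \ldots, x_{n-1})$ is an $(n-1)$-heap game-state of Antonim. Let $$A=\left\{\alpha \in \mathbb{Z}^{\geq 0} \;\middle|\; \exists\, j \in \{1,\ldots,n-1\},\ \exists\, y_j \text{ with } 1 \leq y_j \leq x_j \text{ such that } (x_1,\ldots, x_{j-1},x_j-y_j,x_{j+1},\ldots, x_{n-1},\alpha) \text{ is a } \mathcal{P}\text{ -position}\right\}.$$ Let $S = \mathbb{Z}^{\geq 0} \setminus \left(A \cup \{x_1, \ldots, x_{n-1}\}\right)$ and let $z$ be the least element of $S$. Then $(x_1, x_2, \ldots, x_{n-1}, z)$ is a $\mathcal{P}$-position of Antonim.
   Context: Antonim is a two-player game played on heaps of chips in which no two heaps may ever contain the same number of chips. A game-state is an ordered tuple $(x_1,\ldots,x_m)$ of non-negative integers with $x_i = x_j$ iff $i=j$ (the heap sizes). A move consists of removing a positive number of chips from a single heap, provided the resulting tuple is again a game-state (all entries pairwise distinct). Players alternate moves; a player who cannot move loses. A $\mathcal{P}$-position is a game-state from which the player whose turn it is loses, assuming the opponent plays perfectly; an $\mathcal{N}$-position is any game-state that is not a $\mathcal{P}$-position. The condition that a tuple is a $\mathcal{P}$-position includes that it is a valid game-state. -}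

module Defs where

open import Data.Nat using (ℕ; _≤_; _<_; _∸_; suc)
open import Data.Fin using (Fin)
open import Data.Vec using (Vec; lookup; _[_]≔_)
open import Data.Product using (Σ; _×_; ∃-syntax)
open import Relation.Binary.PropositionalEquality using (_≡_)

IsGameState : ∀ {m} → Vec ℕ m → Set
IsGameState {m} v = (i j : Fin m) → lookup v i ≡ lookup v j → i ≡ j

record Move {m} (s t : Vec ℕ m) : Set where
  constructor move
  field
    heap    : Fin m
    removed : ℕ
    pos     : 1 ≤ removed
    bound   : removed ≤ lookup s heap
    result  : t ≡ s [ heap ]≔ (lookup s heap ∸ removed)
    valid   : IsGameState t

-- P- and N-positions, defined inductively (the game is well-founded, since
-- each move strictly decreases the total number of chips).
data IsP {m} (s : Vec ℕ m) : Set
data IsN {m} (s : Vec ℕ m) : Set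

data IsP {m} s where
  P-intro : IsGameState s → (∀ t → Move s t → IsN t) → IsP s

data IsN {m} s where
  N-intro : IsGameState s → (t : Vec ℕ m) → Move s t → IsP t → IsN s

-- Antonim is finite (every move lowers the total number of chips), so every
-- game-state is decidably a P- or an N-position; this is what makes the
-- negatively stated minimality of z usable.  A move from (x, z) either lowers
-- some x_j, reaching (x′, z), which is not a P-position because z ∉ A; or it
-- lowers z to some w < z not among the x_j, so w ∈ A by minimality, and the
-- move witnessing w ∈ A takes (x, w) to a P-position.
module Submission where

open import Defs
open import Data.Nat using (ℕ; zero; suc; _≤_; _<_; _∸_; z≤n; s≤s)
open import Data.Nat.Properties using (+-monoˡ-<; +-monoʳ-<; ∸-monoʳ-<)
open import Data.Nat.Induction using (<-wellFounded)
open import Data.Fin using (Fin; zero; suc; toℕ; fromℕ; fromℕ<; inject₁)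
open import Data.Fin.Properties using (all?; any?; toℕ<n; toℕ-fromℕ<; fromℕ≢inject₁)
open import Data.Vec using (Vec; _∷_; []; lookup; _[_]≔_; _∷ʳ_; sum)
open import Data.Product using (_×_; _,_; ∃-syntax)
open import Data.Sum using (_⊎_; inj₁; inj₂)
open import Function using (_∘_)
open import Induction.WellFounded using (Acc; acc)
open import Relation.Nullary using (¬_; Dec; yes; no; contradiction)
open import Relation.Nullary.Decidable using (map′; _→-dec_; decidable-stable)
open import Relation.Binary.PropositionalEquality using (_≡_; _≢_; refl; sym; cong; subst; module ≡-Reasoning)
import Data.Nat.Properties as ℕ
import Data.Fin.Properties as Fin

private
  variable
    m : ℕ

anyPositiveUpTo? : ∀ b {Q : ℕ → Set} → (∀ {r} → 1 ≤ r → r ≤ b → Dec (Q r))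
                 → Dec (∃[ r ] (1 ≤ r × r ≤ b × Q r))
anyPositiveUpTo? b {Q} Q? =
  map′ (λ (k , q) → suc (toℕ k) , s≤s z≤n , toℕ<n k , q)
       (λ { (suc r , _ , r<b , q) → fromℕ< r<b , subst (Q ∘ suc) (sym (toℕ-fromℕ< r<b)) q })
       (any? λ k → Q? (s≤s z≤n) (toℕ<n k))

sum-[]≔-< : ∀ (s : Vec ℕ m) i {a} → a < lookup s i → sum (s [ i ]≔ a) < sum s
sum-[]≔-< (x ∷ s) zero    a<x = +-monoˡ-< (sum s) a<x
sum-[]≔-< (x ∷ s) (suc i) a<s = +-monoʳ-< x (sum-[]≔-< s i a<s)

isGameState? : (s : Vec ℕ m) → Dec (IsGameState s)
isGameState? s = all? λ i → all? λ j → (lookup s i ℕ.≟ lookup s j) →-dec (i Fin.≟ j)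

P⇒gameState : {s : Vec ℕ m} → IsP s → IsGameState s
P⇒gameState (P-intro gs _) = gs

P⇒¬N : {s : Vec ℕ m} → IsP s → ¬ IsN s
P⇒¬N (P-intro _ toN) (N-intro _ t mv P) = P⇒¬N P (toN t mv)

HasMoveToP : Vec ℕ m → Set
HasMoveToP s = ∃[ i ] ∃[ r ] (1 ≤ r × r ≤ lookup s i × IsP (s [ i ]≔ (lookup s i ∸ r)))

Determined : Vec ℕ m → Set
Determined s = IsGameState s → IsP s ⊎ IsN s

determined⇒isP? : {s : Vec ℕ m} → Determined s → Dec (IsP s)
determined⇒isP? {s = s} det with isGameState? s
... | no ¬gs = no (¬gs ∘ P⇒gameState)
... | yes gs with det gs
...   | inj₁ P = yes P
...   | inj₂ N = no λ P → P⇒¬N P N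

hasMoveToP? : (s : Vec ℕ m)
            → (∀ i {r} → 1 ≤ r → r ≤ lookup s i → Dec (IsP (s [ i ]≔ (lookup s i ∸ r))))
            → Dec (HasMoveToP s)
hasMoveToP? s P? = any? λ i → anyPositiveUpTo? (lookup s i) (P? i)

determined-acc : (s : Vec ℕ m) → Acc _<_ (sum s) → Determined s
determined-acc s (acc rec) gs =
  decide (hasMoveToP? s λ i 1≤r r≤si → determined⇒isP? (determined-after i 1≤r r≤si))
  where
  determined-after : ∀ i {r} → 1 ≤ r → r ≤ lookup s i → Determined (s [ i ]≔ (lookup s i ∸ r))
  determined-after i 1≤r r≤si = determined-acc _ (rec (sum-[]≔-< s i (∸-monoʳ-< 1≤r r≤si)))

  ¬moveToP⇒toN : ¬ HasMoveToP s → ∀ t → Move s t → IsN t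
  ¬moveToP⇒toN ¬moveToP t (move i r 1≤r r≤si refl valid) with determined-after i 1≤r r≤si valid
  ... | inj₁ P = contradiction (i , r , 1≤r , r≤si , P) ¬moveToP
  ... | inj₂ N = N

  decide : Dec (HasMoveToP s) → IsP s ⊎ IsN s
  decide (yes (i , r , 1≤r , r≤si , P)) = inj₂ (N-intro gs _ (move i r 1≤r r≤si refl (P⇒gameState P)) P)
  decide (no ¬moveToP)                  = inj₁ (P-intro gs (¬moveToP⇒toN ¬moveToP))

determined : (s : Vec ℕ m) → Determined s
determined s = determined-acc s (<-wellFounded (sum s))

isP? : (s : Vec ℕ m) → Dec (IsP s)
isP? s = determined⇒isP? (determined s)

¬P⇒N : {s : Vec ℕ m} → IsGameState s → ¬ IsP s → IsN s
¬P⇒N {s = s} gs ¬P with determined s gs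
... | inj₁ P = contradiction P ¬P
... | inj₂ N = N

lookup-∷ʳ-inject₁ : ∀ (x : Vec ℕ m) z j → lookup (x ∷ʳ z) (inject₁ j) ≡ lookup x j
lookup-∷ʳ-inject₁ (a ∷ x) z zero    = refl
lookup-∷ʳ-inject₁ (a ∷ x) z (suc j) = lookup-∷ʳ-inject₁ x z j

lookup-∷ʳ-fromℕ : ∀ (x : Vec ℕ m) z → lookup (x ∷ʳ z) (fromℕ m) ≡ z
lookup-∷ʳ-fromℕ []      z = refl
lookup-∷ʳ-fromℕ (a ∷ x) z = lookup-∷ʳ-fromℕ x z

[]≔-∷ʳ-inject₁ : ∀ (x : Vec ℕ m) z j a → (x ∷ʳ z) [ inject₁ j ]≔ a ≡ (x [ j ]≔ a) ∷ʳ z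
[]≔-∷ʳ-inject₁ (b ∷ x) z zero    a = refl
[]≔-∷ʳ-inject₁ (b ∷ x) z (suc j) a = cong (b ∷_) ([]≔-∷ʳ-inject₁ x z j a)

[]≔-∷ʳ-fromℕ : ∀ (x : Vec ℕ m) z a → (x ∷ʳ z) [ fromℕ m ]≔ a ≡ x ∷ʳ a
[]≔-∷ʳ-fromℕ []      z a = refl
[]≔-∷ʳ-fromℕ (b ∷ x) z a = cong (b ∷_) ([]≔-∷ʳ-fromℕ x z a)

data LastView : Fin (suc m) → Set where
  last : LastView (fromℕ m)
  init : (j : Fin m) → LastView (inject₁ j)

lastView : (i : Fin (suc m)) → LastView i
lastView {zero}  zero    = last
lastView {suc m} zero    = init zero
lastView {suc m} (suc i) with lastView i
... | last   = last
... | init j = init (suc j)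

Fresh : Vec ℕ m → ℕ → Set
Fresh x z = ∀ j → lookup x j ≢ z

∷ʳ-isGameState : (x : Vec ℕ m) {z : ℕ} → IsGameState x → Fresh x z → IsGameState (x ∷ʳ z)
∷ʳ-isGameState x {z} gs fresh i i′ with lastView i | lastView i′
... | last   | last    = λ _ → refl
... | last   | init j′ rewrite lookup-∷ʳ-fromℕ x z | lookup-∷ʳ-inject₁ x z j′ =
  λ z≡xj′ → contradiction (sym z≡xj′) (fresh j′)
... | init j | last    rewrite lookup-∷ʳ-inject₁ x z j | lookup-∷ʳ-fromℕ x z =
  λ xj≡z → contradiction xj≡z (fresh j)
... | init j | init j′ rewrite lookup-∷ʳ-inject₁ x z j | lookup-∷ʳ-inject₁ x z j′ =
  cong inject₁ ∘ gs j j′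

isGameState-∷ʳ⇒fresh : (x : Vec ℕ m) {z : ℕ} → IsGameState (x ∷ʳ z) → Fresh x z
isGameState-∷ʳ⇒fresh {m} x {z} gs j xj≡z = fromℕ≢inject₁ (sym (gs (inject₁ j) (fromℕ m) same-value))
  where
  open ≡-Reasoning
  same-value : lookup (x ∷ʳ z) (inject₁ j) ≡ lookup (x ∷ʳ z) (fromℕ m)
  same-value = begin
    lookup (x ∷ʳ z) (inject₁ j) ≡⟨ lookup-∷ʳ-inject₁ x z j ⟩
    lookup x j                  ≡⟨ xj≡z ⟩
    z                           ≡⟨ lookup-∷ʳ-fromℕ x z ⟨
    lookup (x ∷ʳ z) (fromℕ m)   ∎

remove-∷ʳ-inject₁ : ∀ (x : Vec ℕ m) z j y
                  → (x ∷ʳ z) [ inject₁ j ]≔ (lookup (x ∷ʳ z) (inject₁ j) ∸ y) ≡ (x [ j ]≔ (lookup x j ∸ y)) ∷ʳ z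
remove-∷ʳ-inject₁ x z j y rewrite lookup-∷ʳ-inject₁ x z j = []≔-∷ʳ-inject₁ x z j _

remove-∷ʳ-fromℕ : ∀ (x : Vec ℕ m) z y
                → (x ∷ʳ z) [ fromℕ m ]≔ (lookup (x ∷ʳ z) (fromℕ m) ∸ y) ≡ x ∷ʳ (z ∸ y)
remove-∷ʳ-fromℕ x z y rewrite lookup-∷ʳ-fromℕ x z = []≔-∷ʳ-fromℕ x z _

data SnocMove (x : Vec ℕ m) (z : ℕ) : Vec ℕ (suc m) → Set where
  inner : ∀ j y → 1 ≤ y → y ≤ lookup x j → SnocMove x z ((x [ j ]≔ (lookup x j ∸ y)) ∷ʳ z)
  outer : ∀ {w} → w < z → SnocMove x z (x ∷ʳ w)

move-∷ʳ-view : {x : Vec ℕ m} {z : ℕ} {t : Vec ℕ (suc m)} → Move (x ∷ʳ z) t → SnocMove x z t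
move-∷ʳ-view {x = x} {z} (move i y 1≤y y≤xi refl _) with lastView i
... | init j = subst (SnocMove x z) (sym (remove-∷ʳ-inject₁ x z j y))
                 (inner j y 1≤y (subst (y ≤_) (lookup-∷ʳ-inject₁ x z j) y≤xi))
... | last   = subst (SnocMove x z) (sym (remove-∷ʳ-fromℕ x z y))
                 (outer (∸-monoʳ-< 1≤y (subst (y ≤_) (lookup-∷ʳ-fromℕ x z) y≤xi)))

A : Vec ℕ m → ℕ → Set
A x α = ∃[ j ] ∃[ y ] (1 ≤ y × y ≤ lookup x j × IsP ((x [ j ]≔ (lookup x j ∸ y)) ∷ʳ α))

A? : (x : Vec ℕ m) (α : ℕ) → Dec (A x α)
A? x α = any? λ j → anyPositiveUpTo? (lookup x j) λ _ _ → isP? _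

A⇒N : {x : Vec ℕ m} {α : ℕ} → IsGameState (x ∷ʳ α) → A x α → IsN (x ∷ʳ α)
A⇒N {x = x} {α} gs (j , y , 1≤y , y≤xj , P) = N-intro gs _ mv P
  where
  mv : Move (x ∷ʳ α) ((x [ j ]≔ (lookup x j ∸ y)) ∷ʳ α)
  mv = move (inject₁ j) y 1≤y (subst (y ≤_) (sym (lookup-∷ʳ-inject₁ x α j)) y≤xj)
            (sym (remove-∷ʳ-inject₁ x α j y)) (P⇒gameState P)

least-outside-A-isP : (x : Vec ℕ m) → IsGameState x → (z : ℕ) → ¬ A x z → Fresh x z
                    → (∀ w → w < z → ¬ (¬ A x w × Fresh x w)) → IsP (x ∷ʳ z)
least-outside-A-isP x gs z z∉A fresh minimal = P-intro (∷ʳ-isGameState x gs fresh) toN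
  where
  toN : ∀ t → Move (x ∷ʳ z) t → IsN t
  toN t mv with move-∷ʳ-view mv
  ... | inner j y 1≤y y≤xj = ¬P⇒N (Move.valid mv) λ P → z∉A (j , y , 1≤y , y≤xj , P)
  ... | outer {w} w<z      = A⇒N (Move.valid mv) (decidable-stable (A? x w) λ w∉A →
                               minimal w w<z (w∉A , isGameState-∷ʳ⇒fresh x (Move.valid mv)))

theorem3 : (n : ℕ) → 2 ≤ n → (x : Vec ℕ (n ∸ 1))
    → IsGameState x → (∀ j → 1 ≤ lookup x j)
    → (z : ℕ)
    -- z ∈ S  (S = ℕ \ (A ∪ {x_1,…,x_{n-1}}))
    → ¬ (∃[ j ] ∃[ y ] (1 ≤ y × y ≤ lookup x j × IsP ((x [ j ]≔ (lookup x j ∸ y)) ∷ʳ z)))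
    → (∀ j → ¬ (lookup x j ≡ z))
    -- z is least in S: every w < z lies in A or among the x_j
    → (∀ w → w < z → ¬ (¬ (∃[ j ] ∃[ y ] (1 ≤ y × y ≤ lookup x j × IsP ((x [ j ]≔ (lookup x j ∸ y)) ∷ʳ w)))
                       × (∀ j → ¬ (lookup x j ≡ w))))
    → IsP (x ∷ʳ z)
theorem3 _ _ x gs _ = least-outside-A-isP x gs
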